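{- Let $k,h$ be positive integers and let $\gamma_k(h)$ be the $k$-th positive element of the greedy $B_h$-set. Then \[\gamma_k(h)\ge \frac1h\left[\binom{k+h}{k}-1\right].\] Consequently, for fixed $k$ we have $\gamma_k(h)\ge \frac{1}{k!}h^{k-1}+O_k(h^{k-2})$ as $h\to\infty$, and for fixed $h$ we have $\gamma_k(h)\ge \frac{1}{h\cdot h!}k^h+O_h(k^{h-1})$ as $k\to\infty$.
   Context: A set $\mathcal A$ of nonnegative integers is a $B_h$-set if every solution of $a_1+\dots+a_h=b_1+\dots+b_h$ with $a_i,b_i\in\mathcal A$ has $\{a_1,\dots,a_h\}=\{b_1,\dots,b_h\}$ as multisets. The greedy $B_h$-set $\{\gamma_0,\gamma_1(h),\gamma_2(h),\dots\}$ is defined by $\gamma_0=0$, $\gamma_1=1$, and, for $k\ge1$, $\gamma_{k+1}(h)$ is the smallest integer $x>\gamma_k(h)$ such that $\{\gamma_0,\gamma_1,\dots,\gamma_k(h),x\}$ is a $B_h$-set. -}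

module Defs where

open import Data.Nat using (ℕ; zero; suc; _+_; _*_; _<_)
open import Data.List using (List; []; _∷_; length; map; upTo; _++_)
open import Data.Nat.ListAction using (sum)
open import Data.List.Relation.Unary.All using (All)
open import Data.List.Membership.Propositional using (_∈_)
open import Data.List.Relation.Binary.Permutation.Propositional using (_↭_)
open import Relation.Binary.PropositionalEquality using (_≡_)
open import Relation.Nullary using (¬_)
open import Data.Product using (_×_)

-- A finite set of naturals, given as a list, is a B_h-set if any two
-- h-term sums a₁+…+a_h = b₁+…+b_h with all aᵢ, bᵢ in A have the same
-- multiset of summands (lists equal up to permutation).
IsBh : ℕ → List ℕ → Set
IsBh h A =
  (as bs : List ℕ) → length as ≡ h → length bs ≡ h →
  All (_∈ A) as → All (_∈ A) bs → sum as ≡ sum bs → as ↭ bs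

initSeg : (ℕ → ℕ) → ℕ → List ℕ
initSeg γ k = map γ (upTo (suc k))

IsGreedyBh : ℕ → (ℕ → ℕ) → Set
IsGreedyBh h γ =
  (γ 0 ≡ 0) × (γ 1 ≡ 1) ×
  ((k : ℕ) → 1 Data.Nat.≤ k →
     (γ k < γ (suc k)) ×
     IsBh h (initSeg γ k ++ (γ (suc k) ∷ [])) ×
     ((x : ℕ) → γ k < x → x < γ (suc k) → ¬ IsBh h (initSeg γ k ++ (x ∷ []))))

-- The first k+1 greedy elements γ₀ < … < γ_k lie in the B_h-set {γ₀,…,γ_k, γ_{k+1}}, so the
-- C(k+h, h) multisets of size h drawn from them have pairwise distinct sums.  These sums all
-- lie in [0, h·γ_k], hence C(k+h, k) ≤ h·γ_k + 1.  The asymptotic forms follow from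
-- m^j·m! ≤ (j+m)!, i.e. m^j ≤ j!·C(j+m, j).
{-# OPTIONS --safe #-}
module Submission where

open import Defs
open import Data.Nat using (ℕ; suc; _+_; _*_; _∸_; _^_; _≤_; _≥_; _!)
open import Data.Nat.Combinatorics using (_C_)
open import Data.Product using (_×_; ∃-syntax)

open import Data.Empty using (⊥-elim)
open import Data.Fin using (Fin; fromℕ<) renaming (zero to fzero; suc to fsuc)
open import Data.Fin.Properties using (injective⇒≤; fromℕ<-injective)
open import Data.List using (List; []; _∷_; length; map; _++_; lookup; applyDownFrom)
open import Data.List.Membership.Propositional using (_∈_)
open import Data.List.Membership.Propositional.Properties
  using (∈-lookup; ∈-map⁺; ∈-upTo⁺; ∈-++⁺ˡ; ∈-applyDownFrom⁻)
open import Data.List.Properties using (length-++; length-map; length-applyDownFrom)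
open import Data.List.Relation.Binary.Permutation.Propositional using (_↭_)
open import Data.List.Relation.Binary.Permutation.Propositional.Properties using (drop-∷; ∈-resp-↭)
open import Data.List.Relation.Binary.Subset.Propositional using (_⊆_)
open import Data.List.Relation.Unary.All as All using (All; []; _∷_)
import Data.List.Relation.Unary.All.Properties as All
open import Data.List.Relation.Unary.AllPairs as AllPairs using (AllPairs; []; _∷_)
import Data.List.Relation.Unary.AllPairs.Properties as AllPairs
open import Data.List.Relation.Unary.Any using (here; there)
open import Data.List.Relation.Unary.Unique.Propositional using (Unique)
open import Data.List.Relation.Unary.Unique.Propositional.Properties using (Unique[x∷xs]⇒x∉xs)
open import Data.Nat using (zero; _<_; z≤n; s≤s; >-nonZero)
open import Data.Nat.Combinatorics
  using (nCk≡nC[n∸k]; nCk≡n!/k![n-k]!; k![n∸k]!∣n!; k>n⇒nCk≡0; nCk+nC[k+1]≡[n+1]C[k+1])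
open import Data.Nat.DivMod using (_/_; m*[n/m]≡n)
open import Data.Nat.ListAction using (sum)
open import Data.Nat.Properties
open import Algebra.Properties.CommutativeSemigroup *-commutativeSemigroup using (xy∙z≈xz∙y; x∙yz≈yx∙z)
open import Data.Product using (_,_; proj₁; proj₂)
open import Data.Sum using (inj₁; inj₂)
open import Function using (_∘_)
open import Relation.Binary.PropositionalEquality
open import Relation.Nullary using (¬_)

[m+n]Cm≡[m+n]Cn : ∀ m n → (m + n) C m ≡ (m + n) C n
[m+n]Cm≡[m+n]Cn m n = trans (nCk≡nC[n∸k] (m≤m+n m n)) (cong ((m + n) C_) (m+n∸m≡n m n))

k!*nCk*[n∸k]!≡n! : ∀ {n k} → k ≤ n → k ! * (n C k) * (n ∸ k) ! ≡ n !
k!*nCk*[n∸k]!≡n! {n} {k} k≤n = begin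
  k ! * (n C k) * (n ∸ k) !                   ≡⟨ xy∙z≈xz∙y (k !) (n C k) ((n ∸ k) !) ⟩
  k ! * (n ∸ k) ! * (n C k)                   ≡⟨ cong (k ! * (n ∸ k) ! *_) (nCk≡n!/k![n-k]! k≤n) ⟩
  k ! * (n ∸ k) ! * (n ! / (k ! * (n ∸ k) !)) ≡⟨ m*[n/m]≡n (k![n∸k]!∣n! k≤n) ⟩
  n !                                         ∎
  where
  open ≡-Reasoning
  instance _ = k !* (n ∸ k) !≢0

m^j*m!≤[j+m]! : ∀ j m → m ^ j * m ! ≤ (j + m) !
m^j*m!≤[j+m]! zero    m = ≤-reflexive (*-identityˡ (m !))
m^j*m!≤[j+m]! (suc j) m = begin
  m * m ^ j * m !          ≡⟨ *-assoc m (m ^ j) (m !) ⟩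
  m * (m ^ j * m !)        ≤⟨ *-mono-≤ (m≤n+m m (suc j)) (m^j*m!≤[j+m]! j m) ⟩
  suc (j + m) * (j + m) !  ∎
  where open ≤-Reasoning

m^j≤j!*[j+m]Cj : ∀ j m → m ^ j ≤ j ! * ((j + m) C j)
m^j≤j!*[j+m]Cj j m = *-cancelʳ-≤ (m ^ j) (j ! * ((j + m) C j)) (m !) {{m !≢0}} (begin
  m ^ j * m !                          ≤⟨ m^j*m!≤[j+m]! j m ⟩
  (j + m) !                            ≡⟨ k!*nCk*[n∸k]!≡n! (m≤m+n j m) ⟨
  j ! * ((j + m) C j) * (j + m ∸ j) !  ≡⟨ cong (λ d → j ! * ((j + m) C j) * d !) (m+n∸m≡n j m) ⟩
  j ! * ((j + m) C j) * m !            ∎)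
  where open ≤-Reasoning

lookup-injective : ∀ {A : Set} {xs : List A} → Unique xs → ∀ {i j} → lookup xs i ≡ lookup xs j → i ≡ j
lookup-injective (_ ∷ _)     {fzero}  {fzero}  _  = refl
lookup-injective u@(_ ∷ _)   {fzero}  {fsuc j} eq = ⊥-elim (Unique[x∷xs]⇒x∉xs u (subst (_∈ _) (sym eq) (∈-lookup j)))
lookup-injective u@(_ ∷ _)   {fsuc i} {fzero}  eq = ⊥-elim (Unique[x∷xs]⇒x∉xs u (subst (_∈ _) eq (∈-lookup i)))
lookup-injective (_ ∷ u)     {fsuc i} {fsuc j} eq = cong fsuc (lookup-injective u eq)

unique-bounded⇒length≤ : ∀ {B} {xs : List ℕ} → Unique xs → All (_≤ B) xs → length xs ≤ suc B
unique-bounded⇒length≤ {B} {xs} u bounded = injective⇒≤ {f = toFin} λ {i} {j} eq →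
  lookup-injective u (fromℕ<-injective (lookup xs i) (lookup xs j) (in-range i) (in-range j) eq)
  where
  in-range : ∀ i → lookup xs i < suc B
  in-range i = s≤s (All.lookup bounded (∈-lookup i))
  toFin : Fin (length xs) → Fin (suc B)
  toFin i = fromℕ< (in-range i)

map-unique-on : ∀ {A B : Set} {R : A → A → Set} {f : A → B} {xs : List A} → AllPairs R xs →
                (∀ {a b} → a ∈ xs → b ∈ xs → R a b → f a ≢ f b) → Unique (map f xs)
map-unique-on []       _   = []
map-unique-on (r ∷ rs) sep =
  All.map⁺ (All.tabulate λ b∈ → sep (here refl) (there b∈) (All.lookup r b∈))
  ∷ map-unique-on rs λ a∈ b∈ → sep (there a∈) (there b∈)

sum≤length*bound : ∀ {B} {xs : List ℕ} → All (_≤ B) xs → sum xs ≤ length xs * B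
sum≤length*bound []             = z≤n
sum≤length*bound (x≤B ∷ bounds) = +-mono-≤ x≤B (sum≤length*bound bounds)

module _ {A : Set} where

  multisets : List A → ℕ → List (List A)
  multisets xs       zero    = [] ∷ []
  multisets []       (suc m) = []
  multisets (x ∷ xs) (suc m) = map (x ∷_) (multisets (x ∷ xs) m) ++ multisets xs (suc m)

  -- The truncated subtraction makes the formula also correct for xs = [].
  length-multisets : ∀ xs m → length (multisets xs m) ≡ (length xs + m ∸ 1) C m
  length-multisets xs       zero    = refl
  length-multisets []       (suc m) = sym (k>n⇒nCk≡0 (n<1+n m))
  length-multisets (x ∷ xs) (suc m) = begin
    length (map (x ∷_) (multisets (x ∷ xs) m) ++ multisets xs (suc m))
      ≡⟨ length-++ (map (x ∷_) (multisets (x ∷ xs) m)) ⟩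
    length (map (x ∷_) (multisets (x ∷ xs) m)) + length (multisets xs (suc m))
      ≡⟨ cong₂ _+_ (trans (length-map (x ∷_) (multisets (x ∷ xs) m)) (length-multisets (x ∷ xs) m))
                   (length-multisets xs (suc m)) ⟩
    (n + m) C m + (n + suc m ∸ 1) C suc m
      ≡⟨ cong (λ l → (n + m) C m + (l ∸ 1) C suc m) (+-suc n m) ⟩
    (n + m) C m + (n + m) C suc m
      ≡⟨ nCk+nC[k+1]≡[n+1]C[k+1] (n + m) m ⟩
    suc (n + m) C suc m
      ≡⟨ cong (λ l → (l ∸ 1) C suc m) (+-suc (suc n) m) ⟨
    (suc n + suc m ∸ 1) C suc m
      ∎
    where
    open ≡-Reasoning
    n = length xs

  multisets-length : ∀ xs m → All (λ ys → length ys ≡ m) (multisets xs m)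
  multisets-length xs       zero    = refl ∷ []
  multisets-length []       (suc m) = []
  multisets-length (x ∷ xs) (suc m) =
    All.++⁺ (All.map⁺ (All.map (cong suc) (multisets-length (x ∷ xs) m))) (multisets-length xs (suc m))

  multisets-⊆ : ∀ xs m → All (All (_∈ xs)) (multisets xs m)
  multisets-⊆ xs       zero    = [] ∷ []
  multisets-⊆ []       (suc m) = []
  multisets-⊆ (x ∷ xs) (suc m) =
    All.++⁺ (All.map⁺ (All.map (here refl ∷_) (multisets-⊆ (x ∷ xs) m)))
            (All.map (All.map there) (multisets-⊆ xs (suc m)))

  multisets-distinct : ∀ {xs} m → Unique xs → AllPairs (λ ys zs → ¬ (ys ↭ zs)) (multisets xs m)
  multisets-distinct          zero    _            = [] ∷ []
  multisets-distinct {[]}     (suc m) _            = []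
  multisets-distinct {x ∷ xs} (suc m) u@(_ ∷ uxs) =
    AllPairs.++⁺ (AllPairs.map⁺ (AllPairs.map (λ ¬p p → ¬p (drop-∷ p)) (multisets-distinct m u)))
                 (multisets-distinct (suc m) uxs)
                 (All.map⁺ (All.tabulate λ _ → All.tabulate λ zs∈ p → x∉xs (x∈ zs∈ p)))
    where
    x∉xs = Unique[x∷xs]⇒x∉xs u
    x∈ : ∀ {ys zs} → zs ∈ multisets xs (suc m) → x ∷ ys ↭ zs → x ∈ xs
    x∈ zs∈ p = All.lookup (All.lookup (multisets-⊆ xs (suc m)) zs∈) (∈-resp-↭ p (here refl))

IsBh-⊆ : ∀ {h A xs} → xs ⊆ A → IsBh h A → IsBh h xs
IsBh-⊆ xs⊆A bh as bs |as| |bs| as⊆xs bs⊆xs = bh as bs |as| |bs| (All.map xs⊆A as⊆xs) (All.map xs⊆A bs⊆xs)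

IsBh⇒C≤ : ∀ {h B xs} → IsBh h xs → Unique xs → All (_≤ B) xs → (length xs + h ∸ 1) C h ≤ suc (h * B)
IsBh⇒C≤ {h} {B} {xs} bh u bounded = begin
  (length xs + h ∸ 1) C h            ≡⟨ length-multisets xs h ⟨
  length (multisets xs h)            ≡⟨ length-map sum (multisets xs h) ⟨
  length (map sum (multisets xs h))  ≤⟨ unique-bounded⇒length≤ sums-unique sums-bounded ⟩
  suc (h * B)                        ∎
  where
  open ≤-Reasoning
  lengths = multisets-length xs h
  members = multisets-⊆ xs h
  sums-unique : Unique (map sum (multisets xs h))
  sums-unique = map-unique-on (multisets-distinct h u) λ ys∈ zs∈ ys≁zs eq →
    ys≁zs (bh _ _ (All.lookup lengths ys∈) (All.lookup lengths zs∈)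
                  (All.lookup members ys∈) (All.lookup members zs∈) eq)
  sums-bounded : All (_≤ h * B) (map sum (multisets xs h))
  sums-bounded = All.map⁺ (All.tabulate λ {ys} ys∈ →
    subst (λ l → sum ys ≤ l * B) (All.lookup lengths ys∈)
      (sum≤length*bound (All.map (All.lookup bounded) (All.lookup members ys∈))))

step⇒strictMono : ∀ {f : ℕ → ℕ} → (∀ n → f n < f (suc n)) → ∀ {i j} → i < j → f i < f j
step⇒strictMono step {j = suc j} (s≤s i≤j) with m≤n⇒m<n∨m≡n i≤j
... | inj₁ i<j  = <-trans (step⇒strictMono step i<j) (step j)
... | inj₂ refl = step j

≤*suc⇒≤*+* : ∀ {m} a n d → 1 ≤ d → m ≤ a * suc n → m ≤ a * n + a * d
≤*suc⇒≤*+* {m} a n d d≥1 m≤ = begin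
  m              ≤⟨ m≤ ⟩
  a * suc n      ≡⟨ *-suc a n ⟩
  a + a * n      ≡⟨ +-comm a (a * n) ⟩
  a * n + a      ≤⟨ +-monoʳ-≤ (a * n) (m≤m*n a d {{>-nonZero d≥1}}) ⟩
  a * n + a * d  ∎
  where open ≤-Reasoning

module _ {h : ℕ} {γ : ℕ → ℕ} (greedy : IsGreedyBh h γ) where

  greedy-strictMono : ∀ {i j} → i < j → γ i < γ j
  greedy-strictMono = step⇒strictMono step
    where
    step : ∀ n → γ n < γ (suc n)
    step zero    rewrite proj₁ greedy | proj₁ (proj₂ greedy) = s≤s z≤n
    step (suc n) = proj₁ (proj₂ (proj₂ greedy) (suc n) (s≤s z≤n))

  greedy-mono : ∀ {i j} → i ≤ j → γ i ≤ γ j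
  greedy-mono i≤j with m≤n⇒m<n∨m≡n i≤j
  ... | inj₁ i<j  = <⇒≤ (greedy-strictMono i<j)
  ... | inj₂ refl = ≤-refl

  greedy-[k+h]Ch≤ : ∀ {k} → 1 ≤ k → (k + h) C h ≤ suc (h * γ k)
  greedy-[k+h]Ch≤ {k} k≥1 = subst (λ n → (n + h ∸ 1) C h ≤ suc (h * γ k)) (length-applyDownFrom γ (suc k))
    (IsBh⇒C≤ (IsBh-⊆ prefix⊆ (proj₁ (proj₂ (proj₂ (proj₂ greedy) k k≥1)))) prefix-unique prefix-bounded)
    where
    prefix = applyDownFrom γ (suc k)
    prefix⊆ : prefix ⊆ initSeg γ k ++ (γ (suc k) ∷ [])
    prefix⊆ x∈ with ∈-applyDownFrom⁻ γ x∈
    ... | i , i<1+k , refl = ∈-++⁺ˡ (∈-map⁺ γ (∈-upTo⁺ i<1+k))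
    prefix-unique : Unique prefix
    prefix-unique = AllPairs.applyDownFrom⁺₁ γ (suc k) λ j<i _ → <⇒≢ (greedy-strictMono j<i) ∘ sym
    prefix-bounded : All (_≤ γ k) prefix
    prefix-bounded = All.tabulate bound
      where
      bound : ∀ {x} → x ∈ prefix → x ≤ γ k
      bound x∈ with ∈-applyDownFrom⁻ γ x∈
      ... | i , s≤s i≤k , refl = greedy-mono i≤k

  greedy-[k+h]Ck≤ : ∀ {k} → 1 ≤ k → (k + h) C k ≤ suc (h * γ k)
  greedy-[k+h]Ck≤ {k} k≥1 = subst (_≤ suc (h * γ k)) (sym ([m+n]Cm≡[m+n]Cn k h)) (greedy-[k+h]Ch≤ k≥1)

  greedy-bound : ∀ {k} → 1 ≤ k → (k + h) C k ∸ 1 ≤ h * γ k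
  greedy-bound k≥1 = ∸-monoˡ-≤ 1 (greedy-[k+h]Ck≤ k≥1)

  greedy-bound-h^k : ∀ {k} → 1 ≤ h → 1 ≤ k → h ^ k ≤ k ! * h * γ k + k ! * h ^ (k ∸ 1)
  greedy-bound-h^k {k} h≥1 k≥1 =
    subst (λ n → h ^ k ≤ n + k ! * h ^ (k ∸ 1)) (sym (*-assoc (k !) h (γ k)))
      (≤*suc⇒≤*+* (k !) (h * γ k) (h ^ (k ∸ 1)) (m^n>0 h {{>-nonZero h≥1}} (k ∸ 1))
        (≤-trans (m^j≤j!*[j+m]Cj k h) (*-monoʳ-≤ (k !) (greedy-[k+h]Ck≤ k≥1))))

  greedy-bound-k^h : ∀ {k} → 1 ≤ k → k ^ h ≤ h * h ! * γ k + h ! * k ^ (h ∸ 1)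
  greedy-bound-k^h {k} k≥1 =
    subst (λ n → k ^ h ≤ n + h ! * k ^ (h ∸ 1)) (x∙yz≈yx∙z (h !) h (γ k))
      (≤*suc⇒≤*+* (h !) (h * γ k) (k ^ (h ∸ 1)) (m^n>0 k {{>-nonZero k≥1}} (h ∸ 1))
        (≤-trans (m^j≤j!*[j+m]Cj h k)
          (*-monoʳ-≤ (h !) (subst (λ n → n C h ≤ suc (h * γ k)) (+-comm k h) (greedy-[k+h]Ch≤ k≥1)))))

lemma5 : ((h k : ℕ) → 1 ≤ h → 1 ≤ k → (γ : ℕ → ℕ) → IsGreedyBh h γ →
    (k + h) C k ∸ 1 ≤ h * γ k)
    × ((k : ℕ) → 1 ≤ k → ∃[ C ] ∃[ H ] ((h : ℕ) → h ≥ H → (γ : ℕ → ℕ) → IsGreedyBh h γ →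
    h ^ k ≤ (k !) * h * γ k + C * h ^ (k ∸ 1)))
    × ((h : ℕ) → 1 ≤ h → (γ : ℕ → ℕ) → IsGreedyBh h γ →
    ∃[ C ] ∃[ K ] ((k : ℕ) → k ≥ K → k ^ h ≤ h * (h !) * γ k + C * k ^ (h ∸ 1)))
lemma5 =
    (λ h k _ k≥1 γ greedy → greedy-bound greedy k≥1)
  , (λ k k≥1 → k ! , 1 , λ h h≥1 γ greedy → greedy-bound-h^k greedy h≥1 k≥1)
  , (λ h _ γ greedy → h ! , 1 , λ k k≥1 → greedy-bound-k^h greedy k≥1)
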